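{- Let $\mathbf{A}$ be a complete Heyting algebra, $\mathbb{P}=(A,X,I)$ a formal $\mathbf{A}$-context and $R:A\times X\to\mathbf{A}$ an $\mathbf{A}$-valued relation. (1) The following are equivalent: (i) $R^{(0)}[\{\alpha/x\}]$ is Galois-stable for every $x\in X$ and $\alpha\in\mathbf{A}$; (ii) $R^{(0)}[u]$ is Galois-stable for every $u:X\to\mathbf{A}$; (iii) $R^{(1)}[f]=R^{(1)}[f^{\uparrow\downarrow}]$ for every $f:A\to\mathbf{A}$. (2) The following are equivalent: (i) $R^{(1)}[\{\alpha/a\}]$ is Galois-stable for every $a\in A$ and $\alpha\in\mathbf{A}$; (ii) $R^{(1)}[f]$ is Galois-stable for every $f:A\to\mathbf{A}$; (iii) $R^{(0)}[u]=R^{(0)}[u^{\downarrow\uparrow}]$ for every $u:X\to\mathbf{A}$.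
   Context: For a set $W$, $\mathbf{A}^W$ is the set of maps $W\to\mathbf{A}$ with the pointwise order. A formal $\mathbf{A}$-context is $(A,X,I)$ with $A,X$ sets and $I:A\times X\to\mathbf{A}$. For $R:A\times X\to\mathbf{A}$, $f\in\mathbf{A}^A$, $u\in\mathbf{A}^X$: $R^{(1)}[f](x)=\bigwedge_{a\in A}(f(a)\to R(a,x))$ and $R^{(0)}[u](a)=\bigwedge_{x\in X}(u(x)\to R(a,x))$. Write $f^\uparrow=I^{(1)}[f]$, $u^\downarrow=I^{(0)}[u]$. A map $f\in\mathbf{A}^A$ is Galois-stable if $f^{\uparrow\downarrow}=f$; $u\in\mathbf{A}^X$ is Galois-stable if $u^{\downarrow\uparrow}=u$. For $\alpha\in\mathbf{A}$ and $w$ in a set $W$, $\{\alpha/w\}:W\to\mathbf{A}$ sends $w$ to $\alpha$ and every other element to $\bot$. -}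

module Defs where

open import Level using (Level; _⊔_) renaming (suc to lsuc)
open import Relation.Binary.PropositionalEquality using (_≡_)
open import Relation.Binary.Lattice.Bundles using (HeytingAlgebra)

record CompleteHeytingAlgebra c ℓ₁ ℓ₂ i : Set (lsuc (c ⊔ ℓ₁ ⊔ ℓ₂ ⊔ i)) where
  field
    heytingAlgebra : HeytingAlgebra c ℓ₁ ℓ₂
  open HeytingAlgebra heytingAlgebra public
  field
    ⋀          : {J : Set i} → (J → Carrier) → Carrier
    ⋀-lower    : {J : Set i} (g : J → Carrier) (j : J) → ⋀ g ≤ g j
    ⋀-greatest : {J : Set i} (g : J → Carrier) (y : Carrier) →
                 ((j : J) → y ≤ g j) → y ≤ ⋀ g
    ⋁          : {J : Set i} → (J → Carrier) → Carrier
    ⋁-upper    : {J : Set i} (g : J → Carrier) (j : J) → g j ≤ ⋁ g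
    ⋁-least    : {J : Set i} (g : J → Carrier) (y : Carrier) →
                 ((j : J) → g j ≤ y) → ⋁ g ≤ y

module _ {c ℓ₁ ℓ₂ i : Level} (𝔸 : CompleteHeytingAlgebra c ℓ₁ ℓ₂ i) where
  open CompleteHeytingAlgebra 𝔸

  R⁽¹⁾ : {A X : Set i} → (A → X → Carrier) → (A → Carrier) → (X → Carrier)
  R⁽¹⁾ {A} R f x = ⋀ {A} (λ a → f a ⇨ R a x)

  R⁽⁰⁾ : {A X : Set i} → (A → X → Carrier) → (X → Carrier) → (A → Carrier)
  R⁽⁰⁾ {X = X} R u a = ⋀ {X} (λ x → u x ⇨ R a x)

  _≐_ : {W : Set i} → (W → Carrier) → (W → Carrier) → Set (i ⊔ ℓ₁)
  f ≐ g = ∀ w → f w ≈ g w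

  -- f is Galois-stable w.r.t. I : f^{↑↓} = f
  GaloisStableᴬ : {A X : Set i} → (A → X → Carrier) → (A → Carrier) → Set (i ⊔ ℓ₁)
  GaloisStableᴬ I f = R⁽⁰⁾ I (R⁽¹⁾ I f) ≐ f

  -- u is Galois-stable w.r.t. I : u^{↓↑} = u
  GaloisStableˣ : {A X : Set i} → (A → X → Carrier) → (X → Carrier) → Set (i ⊔ ℓ₁)
  GaloisStableˣ I u = R⁽¹⁾ I (R⁽⁰⁾ I u) ≐ u

  -- Written constructively
  -- (no decidable equality on W) as  {α/w}(w') = ⋁_{p : w ≡ w'} α,
  -- which classically is α if w' = w and ⊥ otherwise.
  ⟨_/_⟩ : {W : Set i} → Carrier → W → (W → Carrier)
  ⟨ α / w ⟩ w' = ⋁ {w ≡ w'} (λ _ → α)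

-- R⁽⁰⁾ R and R⁽¹⁾ R form an antitone Galois connection between 𝐀^X and 𝐀^A, and
-- swapping the roles of A and X (flipping I and R) exchanges R⁽⁰⁾ and R⁽¹⁾, so
-- part (2) is part (1) for the flipped context.  For part (1): R⁽⁰⁾[u] is the
-- meet over x of R⁽⁰⁾[{u(x)/x}], and a meet of Galois-stable maps is stable,
-- giving (i) ⇒ (ii); (ii) ⇔ (iii) is the adjunction rewriting of
-- "(·)^{↑↓} fixes R⁽⁰⁾[u]" as "R⁽¹⁾[f] does not see the closure of f".
module Submission where

open import Defs
open import Data.Product using (_×_; _,_)
open import Function using (flip)
open import Function.Bundles using (_⇔_; mk⇔)
open import Level using (Level; _⊔_)
open import Relation.Binary.PropositionalEquality using () renaming (refl to ≡-refl)
import Relation.Binary.Lattice.Properties.HeytingAlgebra as HeytingAlgebraProperties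

module _ {c ℓ₁ ℓ₂ i : Level} (𝔸 : CompleteHeytingAlgebra c ℓ₁ ℓ₂ i) where
  open CompleteHeytingAlgebra 𝔸
  open HeytingAlgebraProperties heytingAlgebra using (swap-transpose-⇨; ⇨ˡ-contravariant)

  private
    _≤̇_ : {W : Set i} → (W → Carrier) → (W → Carrier) → Set (i ⊔ ℓ₂)
    f ≤̇ g = ∀ w → f w ≤ g w

    variable
      A X : Set i

  -- R⁽¹⁾ R is definitionally R⁽⁰⁾ (flip R): instantiating at flip R gives the duals.
  R⁽⁰⁾-galois : (R : A → X → Carrier) {f : A → Carrier} {u : X → Carrier} →
                f ≤̇ R⁽⁰⁾ 𝔸 R u → u ≤̇ R⁽¹⁾ 𝔸 R f
  R⁽⁰⁾-galois R f≤R⁽⁰⁾u x = ⋀-greatest _ _ λ a →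
    swap-transpose-⇨ (transpose-∧ (trans (f≤R⁽⁰⁾u a) (⋀-lower _ x)))

  R⁽⁰⁾-R⁽¹⁾-extensive : (R : A → X → Carrier) (f : A → Carrier) →
                        f ≤̇ R⁽⁰⁾ 𝔸 R (R⁽¹⁾ 𝔸 R f)
  R⁽⁰⁾-R⁽¹⁾-extensive R f = R⁽⁰⁾-galois (flip R) (λ _ → refl)

  R⁽⁰⁾-antitone : (R : A → X → Carrier) {u v : X → Carrier} →
                  u ≤̇ v → R⁽⁰⁾ 𝔸 R v ≤̇ R⁽⁰⁾ 𝔸 R u
  R⁽⁰⁾-antitone R u≤v a = ⋀-greatest _ _ λ x →
    trans (⋀-lower _ x) (⇨ˡ-contravariant (u≤v x))

  R⁽⁰⁾-singleton-≤ : (R : A → X → Carrier) (α : Carrier) (x : X) (a : A) →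
                     R⁽⁰⁾ 𝔸 R (⟨_/_⟩ 𝔸 α x) a ≤ α ⇨ R a x
  R⁽⁰⁾-singleton-≤ R α x a =
    trans (⋀-lower _ x) (⇨ˡ-contravariant (⋁-upper (λ _ → α) ≡-refl))

  singleton-≤ : (u : X → Carrier) (x : X) → ⟨_/_⟩ 𝔸 (u x) x ≤̇ u
  singleton-≤ u x w = ⋁-least _ _ λ { ≡-refl → refl }

  module _ (I : A → X → Carrier) where

    closure : (A → Carrier) → (A → Carrier)
    closure f = R⁽⁰⁾ 𝔸 I (R⁽¹⁾ 𝔸 I f)

    closure-monotone : {f g : A → Carrier} → f ≤̇ g → closure f ≤̇ closure g
    closure-monotone f≤g = R⁽⁰⁾-antitone I (R⁽⁰⁾-antitone (flip I) f≤g)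

    closure-≤⇒GaloisStable : {f : A → Carrier} → closure f ≤̇ f → GaloisStableᴬ 𝔸 I f
    closure-≤⇒GaloisStable {f} cl≤f a = antisym (cl≤f a) (R⁽⁰⁾-R⁽¹⁾-extensive I f a)

    module _ (R : A → X → Carrier) where

      singletons-stable⇒R⁽⁰⁾-stable :
        (∀ x α → GaloisStableᴬ 𝔸 I (R⁽⁰⁾ 𝔸 R (⟨_/_⟩ 𝔸 α x))) →
        ∀ u → GaloisStableᴬ 𝔸 I (R⁽⁰⁾ 𝔸 R u)
      singletons-stable⇒R⁽⁰⁾-stable stable u = closure-≤⇒GaloisStable λ a →
        ⋀-greatest _ _ λ x → begin
          closure (R⁽⁰⁾ 𝔸 R u) a                  ≤⟨ closure-monotone (R⁽⁰⁾-antitone R (singleton-≤ u x)) a ⟩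
          closure (R⁽⁰⁾ 𝔸 R (⟨_/_⟩ 𝔸 (u x) x)) a  ≈⟨ stable x (u x) a ⟩
          R⁽⁰⁾ 𝔸 R (⟨_/_⟩ 𝔸 (u x) x) a            ≤⟨ R⁽⁰⁾-singleton-≤ R (u x) x a ⟩
          u x ⇨ R a x                             ∎
        where open import Relation.Binary.Reasoning.PartialOrder poset

      R⁽⁰⁾-stable⇒R⁽¹⁾-closure-invariant :
        (∀ u → GaloisStableᴬ 𝔸 I (R⁽⁰⁾ 𝔸 R u)) →
        ∀ f → _≐_ 𝔸 (R⁽¹⁾ 𝔸 R f) (R⁽¹⁾ 𝔸 R (closure f))
      R⁽⁰⁾-stable⇒R⁽¹⁾-closure-invariant stable f x = antisym
        (R⁽⁰⁾-galois R (λ a → trans (closure-monotone (R⁽⁰⁾-R⁽¹⁾-extensive R f) a)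
                                    (reflexive (stable (R⁽¹⁾ 𝔸 R f) a))) x)
        (R⁽⁰⁾-antitone (flip R) (R⁽⁰⁾-R⁽¹⁾-extensive I f) x)

      R⁽¹⁾-closure-invariant⇒R⁽⁰⁾-stable :
        (∀ f → _≐_ 𝔸 (R⁽¹⁾ 𝔸 R f) (R⁽¹⁾ 𝔸 R (closure f))) →
        ∀ u → GaloisStableᴬ 𝔸 I (R⁽⁰⁾ 𝔸 R u)
      R⁽¹⁾-closure-invariant⇒R⁽⁰⁾-stable invariant u = closure-≤⇒GaloisStable
        (R⁽⁰⁾-galois (flip R) λ x →
          trans (R⁽⁰⁾-R⁽¹⁾-extensive (flip R) u x) (reflexive (invariant (R⁽⁰⁾ 𝔸 R u) x)))

      R⁽⁰⁾-stability-equivalences :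
        ((∀ x α → GaloisStableᴬ 𝔸 I (R⁽⁰⁾ 𝔸 R (⟨_/_⟩ 𝔸 α x)))
          ⇔ (∀ u → GaloisStableᴬ 𝔸 I (R⁽⁰⁾ 𝔸 R u)))
        × ((∀ x α → GaloisStableᴬ 𝔸 I (R⁽⁰⁾ 𝔸 R (⟨_/_⟩ 𝔸 α x)))
          ⇔ (∀ f → _≐_ 𝔸 (R⁽¹⁾ 𝔸 R f) (R⁽¹⁾ 𝔸 R (closure f))))
      R⁽⁰⁾-stability-equivalences =
          mk⇔ singletons-stable⇒R⁽⁰⁾-stable specialise
        , mk⇔ (λ h → R⁽⁰⁾-stable⇒R⁽¹⁾-closure-invariant (singletons-stable⇒R⁽⁰⁾-stable h))
              (λ h → specialise (R⁽¹⁾-closure-invariant⇒R⁽⁰⁾-stable h))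
        where
        specialise : (∀ u → GaloisStableᴬ 𝔸 I (R⁽⁰⁾ 𝔸 R u)) →
                     ∀ x α → GaloisStableᴬ 𝔸 I (R⁽⁰⁾ 𝔸 R (⟨_/_⟩ 𝔸 α x))
        specialise stable x α = stable (⟨_/_⟩ 𝔸 α x)

lemma5p4 : ∀ {c ℓ₁ ℓ₂ i} (𝔸 : CompleteHeytingAlgebra c ℓ₁ ℓ₂ i) {A X : Set i}
    (I R : A → X → CompleteHeytingAlgebra.Carrier 𝔸) →
    (((∀ x α → GaloisStableᴬ 𝔸 I (R⁽⁰⁾ 𝔸 R (⟨_/_⟩ 𝔸 α x)))
        ⇔ (∀ u → GaloisStableᴬ 𝔸 I (R⁽⁰⁾ 𝔸 R u)))
      × ((∀ x α → GaloisStableᴬ 𝔸 I (R⁽⁰⁾ 𝔸 R (⟨_/_⟩ 𝔸 α x)))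
        ⇔ (∀ f → _≐_ 𝔸 (R⁽¹⁾ 𝔸 R f) (R⁽¹⁾ 𝔸 R (R⁽⁰⁾ 𝔸 I (R⁽¹⁾ 𝔸 I f))))))
    ×
    (((∀ a α → GaloisStableˣ 𝔸 I (R⁽¹⁾ 𝔸 R (⟨_/_⟩ 𝔸 α a)))
        ⇔ (∀ f → GaloisStableˣ 𝔸 I (R⁽¹⁾ 𝔸 R f)))
      × ((∀ a α → GaloisStableˣ 𝔸 I (R⁽¹⁾ 𝔸 R (⟨_/_⟩ 𝔸 α a)))
        ⇔ (∀ u → _≐_ 𝔸 (R⁽⁰⁾ 𝔸 R u) (R⁽⁰⁾ 𝔸 R (R⁽¹⁾ 𝔸 I (R⁽⁰⁾ 𝔸 I u))))))
lemma5p4 𝔸 I R =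
  R⁽⁰⁾-stability-equivalences 𝔸 I R , R⁽⁰⁾-stability-equivalences 𝔸 (flip I) (flip R)
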